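{- Let $v\geq 8$ and let $C_v$ be the configuration with point set $\mathbb{Z}_v=\{0,1,\dots,v-1\}$ and blocks $\{i,i+1,i+3\}$ for $i\in\mathbb{Z}_v$. Let $S$ be a blocking set of $C_v$ and let $\mathbf{b}(S)=b_0b_1\cdots b_{v-1}$ be the circular binary word with $b_i=1$ if $i\in S$ and $b_i=0$ otherwise. Then every (circular) subword of $\mathbf{b}(S)$ of length $5$ has weight $2$ or $3$.
   Context: A blocking set is a subset $S$ of the points such that every block contains at least one point of $S$ and at least one point not in $S$. A circular binary word of length $n$ is a sequence $b_0,\dots,b_{n-1}\in\{0,1\}$ with $b_0$ regarded as following $b_{n-1}$; a subword of length $m$ is $b_i,b_{i+1},\dots,b_{i+m-1}$ with indices mod $n$, for some $i$. The weight of a word is its number of $1$s. -}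

module Defs where

open import Data.Nat using (ℕ; zero; suc; _+_; NonZero)
open import Data.Nat.DivMod using (_mod_)
open import Data.Fin using (Fin; toℕ)
open import Data.Bool using (Bool; true; false)
open import Data.List using (List; _∷_; []; map; upTo)
open import Data.Nat.ListAction using (sum)
open import Data.List.Relation.Unary.Any using (Any)
open import Data.Product using (_×_)
open import Relation.Binary.PropositionalEquality using (_≡_)

Subset : ℕ → Set
Subset v = Fin v → Bool

_+ᵥ_ : ∀ {v} .{{_ : NonZero v}} → Fin v → ℕ → Fin v
_+ᵥ_ {v} i k = (toℕ i + k) mod v

block : ∀ {v} .{{_ : NonZero v}} → Fin v → List (Fin v)
block i = (i +ᵥ 0) ∷ (i +ᵥ 1) ∷ (i +ᵥ 3) ∷ []

IsBlockingSet : ∀ v .{{_ : NonZero v}} → Subset v → Set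
IsBlockingSet v S =
  (i : Fin v) → Any (λ x → S x ≡ true) (block i) × Any (λ x → S x ≡ false) (block i)

word : ∀ {v} → Subset v → Fin v → ℕ
word S i with S i
... | true = 1
... | false = 0

subwordWeight : ∀ {v} .{{_ : NonZero v}} → Subset v → Fin v → ℕ → ℕ
subwordWeight S i m = sum (map (λ k → word S (i +ᵥ k)) (upTo m))

module Submission where

-- A block {j, j+1, j+3} whose last two points carry equal colours must have j coloured
-- differently from j+1. Hence two consecutive colour changes, at j+1 and j+2, force a
-- change at j: changes propagate backwards along the word, and since the word is
-- circular, going once around makes them propagate forwards as well. In a window
-- b₀…b₄ the blocks at its first two positions already rule out weights 0, 1, 4 and 5,
-- except for the patterns 01000 and 10111; these have changes at positions 0 and 1 but
-- none at 2, contradicting forward propagation.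

open import Defs
open import Data.Nat using (ℕ; suc; _+_; _%_; _≤_; s≤s; NonZero)
open import Data.Nat.Properties using (+-comm; +-suc)
open import Data.Nat.DivMod using (_mod_; m%n<n; m%n%n≡m%n; [m+n]%n≡m%n; %-distribˡ-+)
open import Data.Nat.ListAction using (sum)
open import Data.Fin using (Fin; toℕ)
open import Data.Fin.Properties using (toℕ-fromℕ<; fromℕ<-cong)
open import Data.Bool using (Bool; true; false; not)
open import Data.Bool.Properties using (not-involutive; ¬-not)
open import Data.List using ([]; _∷_; map; upTo)
open import Data.List.Properties using (map-cong)
open import Data.List.Relation.Unary.All using (All; []; _∷_; lookupAny)
open import Data.List.Relation.Unary.Any using (Any)
open import Data.Product using (_×_; _,_; proj₁; proj₂)
open import Data.Sum using (_⊎_; inj₁; inj₂)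
open import Data.Empty using (⊥; ⊥-elim)
open import Relation.Nullary using (¬_)
open import Relation.Binary.PropositionalEquality using (_≡_; refl; sym; trans; cong; subst)
open Relation.Binary.PropositionalEquality.≡-Reasoning

bit : Bool → ℕ
bit true  = 1
bit false = 0

word≡bit : ∀ {v} (S : Subset v) x → word S x ≡ bit (S x)
word≡bit S x with S x
... | true  = refl
... | false = refl

window-weight : ∀ b₀ b₁ b₂ b₃ b₄ →
  ¬ (b₀ ≡ b₁ × b₁ ≡ b₃) → ¬ (b₁ ≡ b₂ × b₂ ≡ b₄) → (b₁ ≡ not b₀ → b₂ ≡ not b₁ → b₃ ≡ not b₂) →
  sum (map bit (b₀ ∷ b₁ ∷ b₂ ∷ b₃ ∷ b₄ ∷ [])) ≡ 2 ⊎ sum (map bit (b₀ ∷ b₁ ∷ b₂ ∷ b₃ ∷ b₄ ∷ [])) ≡ 3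
window-weight true  true  _     true  _     block₀ _ _ = ⊥-elim (block₀ (refl , refl))
window-weight false false _     false _     block₀ _ _ = ⊥-elim (block₀ (refl , refl))
window-weight _     true  true  _     true  _ block₁ _ = ⊥-elim (block₁ (refl , refl))
window-weight _     false false _     false _ block₁ _ = ⊥-elim (block₁ (refl , refl))
window-weight true  false true  true  _     _ _ flips with flips refl refl
... | ()
window-weight false true  false false _     _ _ flips with flips refl refl
... | ()
window-weight true  true  true  false false _ _ _ = inj₂ refl
window-weight true  true  false false true  _ _ _ = inj₂ refl
window-weight true  true  false false false _ _ _ = inj₁ refl
window-weight true  false true  false true  _ _ _ = inj₂ refl
window-weight true  false true  false false _ _ _ = inj₁ refl
window-weight true  false false true  true  _ _ _ = inj₂ refl
window-weight true  false false false true  _ _ _ = inj₁ refl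
window-weight false true  true  true  false _ _ _ = inj₂ refl
window-weight false true  true  false false _ _ _ = inj₁ refl
window-weight false true  false true  true  _ _ _ = inj₂ refl
window-weight false true  false true  false _ _ _ = inj₁ refl
window-weight false false true  true  true  _ _ _ = inj₂ refl
window-weight false false true  true  false _ _ _ = inj₁ refl
window-weight false false false true  true  _ _ _ = inj₁ refl

Blocking : (ℕ → Bool) → Set
Blocking b = ∀ n → ¬ (b n ≡ b (1 + n) × b (1 + n) ≡ b (3 + n))

Periodic : (ℕ → Bool) → ℕ → Set
Periodic b p = ∀ n → b (n + p) ≡ b n

ChangesAt : (ℕ → Bool) → ℕ → Set
ChangesAt b n = b (suc n) ≡ not (b n)

TwoChangesAt : (ℕ → Bool) → ℕ → Set
TwoChangesAt b n = ChangesAt b n × ChangesAt b (suc n)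

windowWeight : (ℕ → Bool) → ℕ → ℕ → ℕ
windowWeight b t m = sum (map (λ k → bit (b (k + t))) (upTo m))

module _ {b : ℕ → Bool} (blocking : Blocking b) where

  twoChanges-step : ∀ {n} → TwoChangesAt b (suc n) → TwoChangesAt b n
  twoChanges-step {n} (c₁ , c₂) = ¬-not (λ e → blocking n (sym e , b₁≡b₃)) , c₁
    where
    b₁≡b₃ : b (1 + n) ≡ b (3 + n)
    b₁≡b₃ = sym (trans c₂ (trans (cong not c₁) (not-involutive (b (1 + n)))))

  twoChanges-backward : ∀ k {n} → TwoChangesAt b (k + n) → TwoChangesAt b n
  twoChanges-backward 0       c = c
  twoChanges-backward (suc k) c = twoChanges-backward k (twoChanges-step c)

  twoChanges-forward : ∀ {w} → Periodic b (2 + w) → ∀ {n} → TwoChangesAt b n → ChangesAt b (2 + n)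
  twoChanges-forward {w} periodic {n} (c₀ , c₁) =
    proj₁ (twoChanges-backward w (subst (TwoChangesAt b) shift (shifted c₀ , shifted c₁)))
    where
    shifted : ∀ {m} → ChangesAt b m → ChangesAt b (m + (2 + w))
    shifted {m} c = trans (periodic (suc m)) (trans c (cong not (sym (periodic m))))
    shift : n + (2 + w) ≡ w + (2 + n)
    shift = trans (+-comm n (2 + w)) (sym (trans (+-suc w (suc n)) (cong suc (+-suc w n))))

  window-weight-periodic : ∀ {w} → Periodic b (2 + w) → ∀ t →
    windowWeight b t 5 ≡ 2 ⊎ windowWeight b t 5 ≡ 3
  window-weight-periodic periodic t =
    window-weight _ _ _ _ _ (blocking t) (blocking (1 + t))
      (λ c₀ c₁ → twoChanges-forward periodic (c₀ , c₁))

constant-not-split : ∀ {A : Set} (f : A → Bool) {c xs} → All (λ x → f x ≡ c) xs →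
  Any (λ x → f x ≡ true) xs → Any (λ x → f x ≡ false) xs → ⊥
constant-not-split f all anyTrue anyFalse with lookupAny all anyTrue | lookupAny all anyFalse
... | fx≡c , fx≡true | fy≡c , fy≡false with trans (sym fx≡c) fx≡true | trans (sym fy≡c) fy≡false
... | refl | ()

module _ {v : ℕ} .{{_ : NonZero v}} (S : Subset v) where

  circular : ℕ → Bool
  circular n = S (n mod v)

  mod-cong : ∀ {m n} → m % v ≡ n % v → m mod v ≡ n mod v
  mod-cong {m} {n} e = fromℕ<-cong (m % v) (n % v) e (m%n<n m v) (m%n<n n v)

  circular-periodic : Periodic circular v
  circular-periodic n = cong S (mod-cong ([m+n]%n≡m%n n v))

  toℕ-mod-+ : ∀ n k → (toℕ (n mod v) + k) mod v ≡ (k + n) mod v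
  toℕ-mod-+ n k = mod-cong (begin
    (toℕ (n mod v) + k) % v    ≡⟨ cong (λ m → (m + k) % v) (toℕ-fromℕ< (m%n<n n v)) ⟩
    (n % v + k) % v            ≡⟨ %-distribˡ-+ (n % v) k v ⟩
    (n % v % v + k % v) % v    ≡⟨ cong (λ m → (m + k % v) % v) (m%n%n≡m%n n v) ⟩
    (n % v + k % v) % v        ≡⟨ %-distribˡ-+ n k v ⟨
    (n + k) % v                ≡⟨ cong (_% v) (+-comm n k) ⟩
    (k + n) % v                ∎)

  blockingSet⇒blocking : IsBlockingSet v S → Blocking circular
  blockingSet⇒blocking blockingSet n (e₀₁ , e₁₃) =
    constant-not-split S constant (proj₁ (blockingSet (n mod v))) (proj₂ (blockingSet (n mod v)))
    where
    constant : All (λ x → S x ≡ circular n) (block (n mod v))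
    constant = cong S (toℕ-mod-+ n 0)
             ∷ trans (cong S (toℕ-mod-+ n 1)) (sym e₀₁)
             ∷ trans (cong S (toℕ-mod-+ n 3)) (sym (trans e₀₁ e₁₃))
             ∷ []

  subwordWeight≡windowWeight : ∀ i m → subwordWeight S i m ≡ windowWeight circular (toℕ i) m
  subwordWeight≡windowWeight i m = cong sum (map-cong letter (upTo m))
    where
    letter : ∀ k → word S (i +ᵥ k) ≡ bit (circular (k + toℕ i))
    letter k = trans (word≡bit S (i +ᵥ k)) (cong (λ j → bit (S (j mod v))) (+-comm (toℕ i) k))

lemma6 : (v : ℕ) → 8 ≤ v → .{{_ : NonZero v}} → (S : Subset v) → IsBlockingSet v S →
           (i : Fin v) → (subwordWeight S i 5 ≡ 2) ⊎ (subwordWeight S i 5 ≡ 3)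
lemma6 (suc (suc w)) (s≤s (s≤s _)) S blockingSet i
  rewrite subwordWeight≡windowWeight S i 5 =
  window-weight-periodic (blockingSet⇒blocking S blockingSet) (circular-periodic S) (toℕ i)
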